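{- A fusion of nice cographs is a nice cograph.
   Context: A graph $(V,E)$: finite $V$, $E$ a set of two-element subsets of $V$; write $vw$. For disjoint vertex sets, the union $G\vee H$ is $(V(G)\cup V(H),E(G)\cup E(H))$, with colourings inherited. A subgraph $G'$ of $G$ is a portion of $G$ if $G=G'\vee G''$ for some graph $G''$ (possibly $G'$ or $G''$ empty). A fusion of graphs $G$ and $H$ (disjoint vertex sets) is any graph obtained from $G\vee H$ by selecting portions $G'$ of $G$ and $H'$ of $H$ and adding all edges between vertices of $G'$ and vertices of $H'$; for coloured graphs the colouring of the fusion is the one inherited from $G$ and $H$. A cograph is a graph with nonempty vertex set such that for distinct $v,w,x,y$ the edges among $\{v,w,x,y\}$ are not exactly $\{vw,wx,xy\}$. A coloured graph has an equivalence relation $\sim$ on $V$ with $v\sim w$, $v\neq w$ implying $vw\notin E$; classes are colour classes. $W\subseteq V$ induces a matching if $W\ne\emptyset$ and each $w\in W$ has a unique $w'\in W$ with $ww'\in E$. A nice cograph is a cograph with a colouring in which every colour class has at most two vertices and no union of two-vertex colour classes induces a matching. -}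

module Defs where

open import Data.Bool using (Bool; false; T; _∧_; _∨_; not)
open import Data.Empty using (⊥)
open import Data.Product using (Σ; ∃; _×_; _,_)
open import Data.Sum using (_⊎_; inj₁; inj₂)
open import Relation.Nullary using (¬_)
open import Relation.Binary.PropositionalEquality using (_≡_; _≢_)

record RawCG (V : Set) : Set where
  field
    adj : V → V → Bool
    col : V → V → Bool
open RawCG public

record IsColouredGraph {V : Set} (G : RawCG V) : Set where
  field
    adj-sym   : ∀ v w → T (adj G v w) → T (adj G w v)
    adj-irr   : ∀ v → ¬ T (adj G v v)
    col-refl  : ∀ v → T (col G v v)
    col-sym   : ∀ v w → T (col G v w) → T (col G w v)
    col-trans : ∀ u v w → T (col G u v) → T (col G v w) → T (col G u w)
    col-indep : ∀ v w → T (col G v w) → v ≢ w → ¬ T (adj G v w)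

IsCograph : {V : Set} → RawCG V → Set
IsCograph {V} G =
  V ×
  (∀ v w x y →
     v ≢ w → v ≢ x → v ≢ y → w ≢ x → w ≢ y → x ≢ y →
     ¬ ( T (adj G v w) × T (adj G w x) × T (adj G x y)
       × ¬ T (adj G v x) × ¬ T (adj G v y) × ¬ T (adj G w y)))

InducesMatching : {V : Set} → RawCG V → (V → Bool) → Set
InducesMatching {V} G W =
  (∃ λ w → T (W w)) ×
  (∀ w → T (W w) →
     ∃ λ w' → T (W w') × T (adj G w w') ×
       (∀ x → T (W x) → T (adj G w x) → x ≡ w'))

UnionOfTwoVertexClasses : {V : Set} → RawCG V → (V → Bool) → Set
UnionOfTwoVertexClasses {V} G W =
  ∀ w → T (W w) →
    (∀ x → T (col G w x) → T (W x)) ×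
    (∃ λ x → x ≢ w × T (col G w x))

ClassesAtMostTwo : {V : Set} → RawCG V → Set
ClassesAtMostTwo G =
  ∀ u v w → T (col G u v) → T (col G u w) →
    (u ≡ v) ⊎ (u ≡ w) ⊎ (v ≡ w)

record IsNiceCograph {V : Set} (G : RawCG V) : Set where
  field
    colouredGraph : IsColouredGraph G
    cograph       : IsCograph G
    classes≤2     : ClassesAtMostTwo G
    noMatching    : ∀ W → UnionOfTwoVertexClasses G W → ¬ InducesMatching G W

-- A portion of G: a subgraph G' = (vs₁, E₁) such that G = G' ∨ G'' for some
-- graph G'' = (vs₂, E₂) with vertex set disjoint from that of G'.
record Portion {V : Set} (G : RawCG V) : Set where
  field
    vs₁ vs₂   : V → Bool
    E₁ E₂     : V → V → Bool
    E₁-sym    : ∀ v w → T (E₁ v w) → T (E₁ w v)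
    E₂-sym    : ∀ v w → T (E₂ v w) → T (E₂ w v)
    E₁-sub    : ∀ v w → T (E₁ v w) → T (vs₁ v) × T (vs₁ w) × T (adj G v w)
    E₂-sub    : ∀ v w → T (E₂ v w) → T (vs₂ v) × T (vs₂ w) × T (adj G v w)
    disjoint  : ∀ v → ¬ (T (vs₁ v) × T (vs₂ v))
    cover     : ∀ v → T (vs₁ v) ⊎ T (vs₂ v)
    E-cover   : ∀ v w → T (adj G v w) → T (E₁ v w) ⊎ T (E₂ v w)
open Portion public

fusion : {V W : Set} (G : RawCG V) (H : RawCG W) →
         Portion G → Portion H → RawCG (V ⊎ W)
fusion G H P Q = record { adj = a ; col = c }
  where
  a : _ → _ → Bool
  a (inj₁ v) (inj₁ v') = adj G v v'
  a (inj₂ w) (inj₂ w') = adj H w w'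
  a (inj₁ v) (inj₂ w)  = vs₁ P v ∧ vs₁ Q w
  a (inj₂ w) (inj₁ v)  = vs₁ Q w ∧ vs₁ P v
  c : _ → _ → Bool
  c (inj₁ v) (inj₁ v') = col G v v'
  c (inj₂ w) (inj₂ w') = col H w w'
  c (inj₁ v) (inj₂ w)  = false
  c (inj₂ w) (inj₁ v)  = false

-- A fusion adds a complete bipartite graph between the chosen portions, which are
-- unions of components. An induced P₄ is connected, so it lies inside the attached part
-- or inside the rest; in the attached part two vertices from different sides are always
-- adjacent, while the three non-edges of a P₄ connect all four vertices, so in both cases
-- the P₄ lies in G or in H. For the matching condition, if the matched set W has no edge
-- between the two sides, its part in G or in H violates niceness of G or of H. Otherwise
-- W contains such an edge pq, so p and q are attached; since q is adjacent to every
-- attached vertex of G, p is the only vertex of W ∩ G matched across. Then W ∩ G minus p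
-- is perfectly matched inside G, while W ∩ G is perfectly matched by its colour classes,
-- and both sets cannot have even size.
module Submission where

open import Defs
open import Data.Bool using (Bool; true; false; T; not; _∧_; if_then_else_)
open import Data.Bool.Properties using (T-∧; ∧-comm)
open import Data.Fin using (Fin; zero; suc)
open import Data.Fin.Properties using (_≟_; any?)
open import Data.Nat using (ℕ; zero; suc)
open import Data.Nat.Properties using (suc-injective)
open import Data.Product using (∃; ∃₂; _×_; _,_; proj₁; proj₂)
open import Data.Sum as Sum using (_⊎_; inj₁; inj₂)
open import Data.Sum.Properties using (inj₁-injective; inj₂-injective)
open import Function using (_∘_; _⇔_; Equivalence)
open import Function.Definitions using (Injective)
open import Relation.Binary.Definitions using (Symmetric)
open import Relation.Binary.PropositionalEquality
  using (_≡_; _≢_; refl; sym; trans; cong; subst)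
open import Relation.Nullary using (¬_; Dec; yes; no; does; contradiction)
open import Relation.Nullary.Decidable using (T?; _×-dec_)

open Equivalence using (to; from)

data Even : ℕ → Set where
  zero : Even zero
  2+_  : ∀ {n} → Even n → Even (suc (suc n))

Even⇒¬Even-suc : ∀ {n} → Even n → ¬ Even (suc n)
Even⇒¬Even-suc zero     ()
Even⇒¬Even-suc (2+ e) (2+ e′) = Even⇒¬Even-suc e e′

count : ∀ {m} → (Fin m → Bool) → ℕ
count {zero}  S = 0
count {suc m} S = if S zero then suc (count (S ∘ suc)) else count (S ∘ suc)

-- The test comes first so that (S without x) ∘ suc computes to (S ∘ suc) without x′ for
-- x = suc x′, and to S ∘ suc for x = zero.
_without_ : ∀ {m} → (Fin m → Bool) → Fin m → Fin m → Bool
(S without x) z = not (does (z ≟ x)) ∧ S z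

module _ {m} (S : Fin m → Bool) {x z : Fin m} where

  without⁺ : T (S z) → z ≢ x → T ((S without x) z)
  without⁺ Sz z≢x with z ≟ x
  ... | yes z≡x = contradiction z≡x z≢x
  ... | no _    = Sz

  without⁻ : T ((S without x) z) → T (S z) × z ≢ x
  without⁻ Sz with z ≟ x
  ... | no z≢x = Sz , z≢x

count-without : ∀ {m} (S : Fin m → Bool) {x} → T (S x) → count S ≡ suc (count (S without x))
count-without {suc m} S {zero}  Sx with S zero
... | true = refl
count-without {suc m} S {suc x} Sx with S zero
... | true  = cong suc (count-without (S ∘ suc) Sx)
... | false = count-without (S ∘ suc) Sx

count≡suc⇒nonempty : ∀ {m} (S : Fin m → Bool) {k} → count S ≡ suc k → ∃ λ x → T (S x)
count≡suc⇒nonempty {suc m} S c with S zero in S0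
... | true  = zero , subst T (sym S0) _
... | false = let x , Sx = count≡suc⇒nonempty (S ∘ suc) c in suc x , Sx

Adjacent : {A : Set} → RawCG A → A → A → Set
Adjacent G v w = T (adj G v w)

-- InducesMatching G W unfolds to (∃ λ w → T (W w)) × IsPerfectMatching (Adjacent G) W.
IsPerfectMatching : {A : Set} → (A → A → Set) → (A → Bool) → Set
IsPerfectMatching R S =
  ∀ x → T (S x) → ∃ λ y → T (S y) × R x y × (∀ z → T (S z) → R x z → z ≡ y)

module _ {A : Set} {R : A → A → Set} {S : A → Bool} (pm : IsPerfectMatching R S) where

  perfectMatching-unique : ∀ {x y z} → T (S x) → T (S y) → T (S z) → R x y → R x z → y ≡ z
  perfectMatching-unique {x} {y} {z} Sx Sy Sz Rxy Rxz =
    let _ , _ , _ , unique = pm x Sx in trans (unique y Sy Rxy) (sym (unique z Sz Rxz))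

  perfectMatching-pullback : ∀ {A′ : Set} {S′ : A′ → Bool} (ι : A′ → A) → Injective _≡_ _≡_ ι →
    (∀ {a} → T (S′ a) → T (S (ι a))) →
    (∀ {a b} → T (S′ a) → T (S b) → R (ι a) b → ∃ λ a′ → ι a′ ≡ b × T (S′ a′)) →
    IsPerfectMatching (λ a a′ → R (ι a) (ι a′)) S′
  perfectMatching-pullback ι ι-injective S′⊆S closed a S′a with pm (ι a) (S′⊆S S′a)
  ... | b , Sb , Rab , unique with closed S′a Sb Rab
  ... | a′ , refl , S′a′ =
    a′ , S′a′ , Rab , λ z S′z Raz → ι-injective (unique (ι z) (S′⊆S S′z) Raz)

module _ {m} {R : Fin m → Fin m → Set} (R-sym : Symmetric R) where

  perfectMatching-without-pair : ∀ {S} → IsPerfectMatching R S → ∀ {x y} →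
    T (S x) → T (S y) → R x y → IsPerfectMatching R ((S without x) without y)
  perfectMatching-without-pair {S} pm {x} {y} Sx Sy Rxy z S″z
    with without⁻ (S without x) S″z
  ... | S′z , z≢y with without⁻ S S′z
  ... | Sz , z≢x with pm z Sz
  ... | y′ , Sy′ , Rzy′ , unique =
    y′ , without⁺ (S without x) (without⁺ S Sy′ y′≢x) y′≢y , Rzy′ ,
    λ w S″w → unique w (proj₁ (without⁻ S (proj₁ (without⁻ (S without x) S″w))))
    where
    y′≢x : y′ ≢ x
    y′≢x refl = z≢y (perfectMatching-unique pm Sx Sz Sy (R-sym Rzy′) Rxy)
    y′≢y : y′ ≢ y
    y′≢y refl = z≢x (perfectMatching-unique pm Sy Sz Sx (R-sym Rzy′) (R-sym Rxy))

module _ {m} {R : Fin m → Fin m → Set} (R-sym : Symmetric R) (R-irr : ∀ {x} → ¬ R x x) where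

  perfectMatching-removePair : ∀ {S k} → IsPerfectMatching R S → count S ≡ suc k →
    ∃ λ S′ → count S ≡ suc (suc (count S′)) × IsPerfectMatching R S′
  perfectMatching-removePair {S} pm c with count≡suc⇒nonempty S c
  ... | x , Sx with pm x Sx
  ... | y , Sy , Rxy , _ =
    (S without x) without y ,
    trans (count-without S Sx) (cong suc (count-without (S without x) (without⁺ S Sy y≢x))) ,
    perfectMatching-without-pair R-sym pm Sx Sy Rxy
    where
    y≢x : y ≢ x
    y≢x refl = R-irr Rxy

  perfectMatching⇒even : ∀ {S} → IsPerfectMatching R S → Even (count S)
  perfectMatching⇒even pm = go _ refl pm
    where
    go : ∀ k {S} → count S ≡ k → IsPerfectMatching R S → Even k
    go zero          _ _ = zero
    go (suc zero)    c pm with perfectMatching-removePair pm c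
    ... | _ , c′ , _ = contradiction (trans (sym c) c′) λ ()
    go (suc (suc k)) c pm with perfectMatching-removePair pm c
    ... | _ , c′ , pm′ = 2+ go k (suc-injective (suc-injective (trans (sym c′) c))) pm′

Mate : {A : Set} → RawCG A → A → A → Set
Mate G v w = T (col G v w) × v ≢ w

module _ {A : Set} {G : RawCG A} (cg : IsColouredGraph G) where
  open IsColouredGraph cg

  Mate-sym : Symmetric (Mate G)
  Mate-sym (c , v≢w) = col-sym _ _ c , v≢w ∘ sym

  Mate-irr : ∀ {v} → ¬ Mate G v v
  Mate-irr (_ , v≢v) = v≢v refl

twoVertexClasses⇒perfectMatching : ∀ {A} {G : RawCG A} {W} → ClassesAtMostTwo G →
  UnionOfTwoVertexClasses G W → IsPerfectMatching (Mate G) W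
twoVertexClasses⇒perfectMatching {G = G} {W} classes≤2 U w Ww with U w Ww
... | closed , x , x≢w , col-wx = x , closed x col-wx , (col-wx , x≢w ∘ sym) , unique
  where
  unique : ∀ z → T (W z) → Mate G w z → z ≡ x
  unique z _ (col-wz , w≢z) with classes≤2 w x z col-wx col-wz
  ... | inj₁ w≡x          = contradiction (sym w≡x) x≢w
  ... | inj₂ (inj₁ w≡z)   = contradiction w≡z w≢z
  ... | inj₂ (inj₂ x≡z)   = sym x≡z

vs₁-closed : ∀ {A} {G : RawCG A} (P : Portion G) {a b} →
  T (adj G a b) → T (vs₁ P a) → T (vs₁ P b)
vs₁-closed P {a} {b} e Pa with E-cover P a b e
... | inj₁ e₁ = proj₁ (proj₂ (E₁-sub P a b e₁))
... | inj₂ e₂ = contradiction (Pa , proj₁ (E₂-sub P a b e₂)) (disjoint P a)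

IsP4 : {A : Set} → RawCG A → A → A → A → A → Set
IsP4 G v w x y = T (adj G v w) × T (adj G w x) × T (adj G x y)
               × ¬ T (adj G v x) × ¬ T (adj G v y) × ¬ T (adj G w y)

module Fusion {A B : Set} (G : RawCG A) (H : RawCG B) (P : Portion G) (Q : Portion H) where

  F : RawCG (A ⊎ B)
  F = fusion G H P Q

  adj-cross : ∀ a b → T (adj F (inj₁ a) (inj₂ b)) ⇔ (T (vs₁ P a) × T (vs₁ Q b))
  adj-cross a b = T-∧

  adj-cross′ : ∀ a b → T (adj F (inj₂ b) (inj₁ a)) ⇔ (T (vs₁ Q b) × T (vs₁ P a))
  adj-cross′ a b = T-∧

  fusion-colouredGraph : IsColouredGraph G → IsColouredGraph H → IsColouredGraph F
  fusion-colouredGraph cgG cgH = record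
    { adj-sym   = adj-sym′
    ; adj-irr   = Sum.[ G.adj-irr , H.adj-irr ]
    ; col-refl  = Sum.[ G.col-refl , H.col-refl ]
    ; col-sym   = col-sym′
    ; col-trans = col-trans′
    ; col-indep = col-indep′
    }
    where
    module G = IsColouredGraph cgG
    module H = IsColouredGraph cgH
    adj-sym′ : ∀ u v → T (adj F u v) → T (adj F v u)
    adj-sym′ (inj₁ a) (inj₁ a′) = G.adj-sym a a′
    adj-sym′ (inj₂ b) (inj₂ b′) = H.adj-sym b b′
    adj-sym′ (inj₁ a) (inj₂ b)  = subst T (∧-comm (vs₁ P a) (vs₁ Q b))
    adj-sym′ (inj₂ b) (inj₁ a)  = subst T (∧-comm (vs₁ Q b) (vs₁ P a))
    col-sym′ : ∀ u v → T (col F u v) → T (col F v u)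
    col-sym′ (inj₁ a) (inj₁ a′) = G.col-sym a a′
    col-sym′ (inj₂ b) (inj₂ b′) = H.col-sym b b′
    col-trans′ : ∀ u v w → T (col F u v) → T (col F v w) → T (col F u w)
    col-trans′ (inj₁ a) (inj₁ a′) (inj₁ a″) = G.col-trans a a′ a″
    col-trans′ (inj₂ b) (inj₂ b′) (inj₂ b″) = H.col-trans b b′ b″
    col-indep′ : ∀ u v → T (col F u v) → u ≢ v → ¬ T (adj F u v)
    col-indep′ (inj₁ a) (inj₁ a′) c a≢a′ = G.col-indep a a′ c (a≢a′ ∘ cong inj₁)
    col-indep′ (inj₂ b) (inj₂ b′) c b≢b′ = H.col-indep b b′ c (b≢b′ ∘ cong inj₂)

  fusion-classesAtMostTwo : ClassesAtMostTwo G → ClassesAtMostTwo H → ClassesAtMostTwo F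
  fusion-classesAtMostTwo ≤2G ≤2H (inj₁ u) (inj₁ v) (inj₁ w) cuv cuw =
    Sum.map (cong inj₁) (Sum.map (cong inj₁) (cong inj₁)) (≤2G u v w cuv cuw)
  fusion-classesAtMostTwo ≤2G ≤2H (inj₂ u) (inj₂ v) (inj₂ w) cuv cuw =
    Sum.map (cong inj₂) (Sum.map (cong inj₂) (cong inj₂)) (≤2H u v w cuv cuw)

  attached : A ⊎ B → Bool
  attached (inj₁ a) = vs₁ P a
  attached (inj₂ b) = vs₁ Q b

  data SameSide : A ⊎ B → A ⊎ B → Set where
    left  : ∀ {a a′} → SameSide (inj₁ a) (inj₁ a′)
    right : ∀ {b b′} → SameSide (inj₂ b) (inj₂ b′)

  SameSide-sym : ∀ {u v} → SameSide u v → SameSide v u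
  SameSide-sym left  = left
  SameSide-sym right = right

  SameSide-trans : ∀ {u v w} → SameSide u v → SameSide v w → SameSide u w
  SameSide-trans left  left  = left
  SameSide-trans right right = right

  attached-closed : ∀ u v → T (adj F u v) → T (attached u) → T (attached v)
  attached-closed (inj₁ a) (inj₁ a′) e = vs₁-closed P e
  attached-closed (inj₂ b) (inj₂ b′) e = vs₁-closed Q e
  attached-closed (inj₁ a) (inj₂ b)  e _ = proj₂ (to (adj-cross a b) e)
  attached-closed (inj₂ b) (inj₁ a)  e _ = proj₂ (to (adj-cross′ a b) e)

  detached-adj⇒SameSide : ∀ u v → T (adj F u v) → ¬ T (attached u) → SameSide u v
  detached-adj⇒SameSide (inj₁ a) (inj₁ a′) _ _ = left
  detached-adj⇒SameSide (inj₂ b) (inj₂ b′) _ _ = right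
  detached-adj⇒SameSide (inj₁ a) (inj₂ b)  e ¬Pa = contradiction (proj₁ (to (adj-cross a b) e)) ¬Pa
  detached-adj⇒SameSide (inj₂ b) (inj₁ a)  e ¬Qb = contradiction (proj₁ (to (adj-cross′ a b) e)) ¬Qb

  attached-nonadj⇒SameSide : ∀ u v → T (attached u) → T (attached v) → ¬ T (adj F u v) →
    SameSide u v
  attached-nonadj⇒SameSide (inj₁ a) (inj₁ a′) _ _ _ = left
  attached-nonadj⇒SameSide (inj₂ b) (inj₂ b′) _ _ _ = right
  attached-nonadj⇒SameSide (inj₁ a) (inj₂ b) Pa Qb ¬e =
    contradiction (from (adj-cross a b) (Pa , Qb)) ¬e
  attached-nonadj⇒SameSide (inj₂ b) (inj₁ a) Qb Pa ¬e =
    contradiction (from (adj-cross′ a b) (Qb , Pa)) ¬e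

  module _ (F-adj-sym : ∀ u v → T (adj F u v) → T (adj F v u)) where

    P4-SameSide : ∀ v w x y → IsP4 F v w x y → SameSide v w × SameSide w x × SameSide x y
    P4-SameSide v w x y (vw , wx , xy , ¬vx , ¬vy , ¬wy) with T? (attached v)
    ... | yes Av =
      let Aw = attached-closed v w vw Av
          Ax = attached-closed w x wx Aw
          Ay = attached-closed x y xy Ax
          v~x = attached-nonadj⇒SameSide v x Av Ax ¬vx
          v~y = attached-nonadj⇒SameSide v y Av Ay ¬vy
          w~y = attached-nonadj⇒SameSide w y Aw Ay ¬wy
          v~w = SameSide-trans v~y (SameSide-sym w~y)
      in v~w , SameSide-trans (SameSide-sym v~w) v~x , SameSide-trans (SameSide-sym v~x) v~y
    ... | no ¬Av =
      let ¬Aw = ¬Av ∘ attached-closed w v (F-adj-sym v w vw)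
          ¬Ax = ¬Aw ∘ attached-closed x w (F-adj-sym w x wx)
      in detached-adj⇒SameSide v w vw ¬Av , detached-adj⇒SameSide w x wx ¬Aw ,
         detached-adj⇒SameSide x y xy ¬Ax

    fusion-cograph : IsCograph G → IsCograph H → IsCograph F
    fusion-cograph (a , noP4G) (_ , noP4H) = inj₁ a , noP4
      where
      noP4 : ∀ v w x y → v ≢ w → v ≢ x → v ≢ y → w ≢ x → w ≢ y → x ≢ y → ¬ IsP4 F v w x y
      noP4 v w x y d₁ d₂ d₃ d₄ d₅ d₆ p with P4-SameSide v w x y p
      ... | left , left , left = noP4G _ _ _ _ (d₁ ∘ cong inj₁) (d₂ ∘ cong inj₁) (d₃ ∘ cong inj₁)
                                   (d₄ ∘ cong inj₁) (d₅ ∘ cong inj₁) (d₆ ∘ cong inj₁) p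
      ... | right , right , right = noP4H _ _ _ _ (d₁ ∘ cong inj₂) (d₂ ∘ cong inj₂) (d₃ ∘ cong inj₂)
                                      (d₄ ∘ cong inj₂) (d₅ ∘ cong inj₂) (d₆ ∘ cong inj₂) p

  CrossEdge : (A ⊎ B → Bool) → Set
  CrossEdge W = ∃₂ λ a b → T (W (inj₁ a)) × T (W (inj₂ b)) × Adjacent F (inj₁ a) (inj₂ b)

  module _ (niceG : IsNiceCograph G) (niceH : IsNiceCograph H) where
    open IsNiceCograph

    colouredGraphF : IsColouredGraph F
    colouredGraphF = fusion-colouredGraph (colouredGraph niceG) (colouredGraph niceH)

    F-adj-sym : ∀ u v → T (adj F u v) → T (adj F v u)
    F-adj-sym = IsColouredGraph.adj-sym colouredGraphF

    twoVertexClasses-left : ∀ {W} → UnionOfTwoVertexClasses F W →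
      UnionOfTwoVertexClasses G (W ∘ inj₁)
    twoVertexClasses-left U a Wa with U (inj₁ a) Wa
    ... | closed , inj₁ a′ , a′≢a , c = closed ∘ inj₁ , a′ , a′≢a ∘ cong inj₁ , c

    twoVertexClasses-right : ∀ {W} → UnionOfTwoVertexClasses F W →
      UnionOfTwoVertexClasses H (W ∘ inj₂)
    twoVertexClasses-right U b Wb with U (inj₂ b) Wb
    ... | closed , inj₂ b′ , b′≢b , c = closed ∘ inj₂ , b′ , b′≢b ∘ cong inj₂ , c

    matching-left : ∀ {W} → IsPerfectMatching (Adjacent F) W → ¬ CrossEdge W →
      IsPerfectMatching (Adjacent G) (W ∘ inj₁)
    matching-left {W} pm ¬cross =
      perfectMatching-pullback pm inj₁ inj₁-injective (λ Wa → Wa) closed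
      where
      closed : ∀ {a u} → T (W (inj₁ a)) → T (W u) → Adjacent F (inj₁ a) u →
        ∃ λ a′ → inj₁ a′ ≡ u × T (W (inj₁ a′))
      closed {u = inj₁ a′} _  Wa′ _ = a′ , refl , Wa′
      closed {a} {inj₂ b}  Wa Wb  e = contradiction (a , b , Wa , Wb , e) ¬cross

    matching-right : ∀ {W} → IsPerfectMatching (Adjacent F) W → ¬ CrossEdge W →
      IsPerfectMatching (Adjacent H) (W ∘ inj₂)
    matching-right {W} pm ¬cross =
      perfectMatching-pullback pm inj₂ inj₂-injective (λ Wb → Wb) closed
      where
      closed : ∀ {b u} → T (W (inj₂ b)) → T (W u) → Adjacent F (inj₂ b) u →
        ∃ λ b′ → inj₂ b′ ≡ u × T (W (inj₂ b′))
      closed {u = inj₂ b′} _  Wb′ _ = b′ , refl , Wb′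
      closed {b} {inj₁ a}  Wb Wa  e =
        contradiction (a , b , Wa , Wb , F-adj-sym (inj₂ b) (inj₁ a) e) ¬cross

    matching⇒¬¬crossEdge : ∀ {W} → UnionOfTwoVertexClasses F W → InducesMatching F W →
      ¬ ¬ CrossEdge W
    matching⇒¬¬crossEdge {W} U ((inj₁ a , Wa) , pm) ¬cross =
      noMatching niceG (W ∘ inj₁) (twoVertexClasses-left U) ((a , Wa) , matching-left pm ¬cross)
    matching⇒¬¬crossEdge {W} U ((inj₂ b , Wb) , pm) ¬cross =
      noMatching niceH (W ∘ inj₂) (twoVertexClasses-right U) ((b , Wb) , matching-right pm ¬cross)

module FiniteFusion {m n} (G : RawCG (Fin m)) (H : RawCG (Fin n)) (P : Portion G) (Q : Portion H)
                    (niceG : IsNiceCograph G) (niceH : IsNiceCograph H) where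
  open Fusion G H P Q
  open IsNiceCograph

  crossEdge? : ∀ W → Dec (CrossEdge W)
  crossEdge? W = any? λ a → any? λ b →
    T? (W (inj₁ a)) ×-dec T? (W (inj₂ b)) ×-dec T? (adj F (inj₁ a) (inj₂ b))

  crossEdge⇒adjacentMatching : ∀ {W} → IsPerfectMatching (Adjacent F) W →
    ∀ {p q} → T (W (inj₁ p)) → T (W (inj₂ q)) → Adjacent F (inj₁ p) (inj₂ q) →
    IsPerfectMatching (Adjacent G) ((W ∘ inj₁) without p)
  crossEdge⇒adjacentMatching {W} pm {p} {q} Wp Wq pq =
    perfectMatching-pullback pm inj₁ inj₁-injective (proj₁ ∘ without⁻ Wₗ) closed
    where
    Wₗ = W ∘ inj₁
    closed : ∀ {a u} → T ((Wₗ without p) a) → T (W u) → Adjacent F (inj₁ a) u →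
      ∃ λ a′ → inj₁ a′ ≡ u × T ((Wₗ without p) a′)
    closed {a} {inj₁ g} W′a Wg ag = g , refl , without⁺ Wₗ Wg g≢p
      where
      g≢p : g ≢ p
      g≢p refl = contradiction
        (perfectMatching-unique pm Wp (proj₁ (without⁻ Wₗ W′a)) Wq
          (F-adj-sym niceG niceH (inj₁ a) (inj₁ p) ag) pq)
        λ ()
    closed {a} {inj₂ h} W′a Wh ah = contradiction a≡p (proj₂ (without⁻ Wₗ W′a))
      where
      qa : Adjacent F (inj₂ q) (inj₁ a)
      qa = from (adj-cross′ a q) (proj₂ (to (adj-cross p q) pq) , proj₁ (to (adj-cross a h) ah))
      a≡p : a ≡ p
      a≡p = inj₁-injective (perfectMatching-unique pm Wq (proj₁ (without⁻ Wₗ W′a)) Wp qa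
              (F-adj-sym niceG niceH (inj₁ p) (inj₂ q) pq))

  crossEdge⇒¬matching : ∀ {W} → UnionOfTwoVertexClasses F W → IsPerfectMatching (Adjacent F) W →
    ¬ CrossEdge W
  crossEdge⇒¬matching {W} U pm (p , q , Wp , Wq , pq) =
    Even⇒¬Even-suc
      (perfectMatching⇒even (G.adj-sym _ _) (G.adj-irr _)
        (crossEdge⇒adjacentMatching pm Wp Wq pq))
      (subst Even (count-without (W ∘ inj₁) Wp)
        (perfectMatching⇒even (Mate-sym cgG) (Mate-irr cgG)
          (twoVertexClasses⇒perfectMatching {G = G} (classes≤2 niceG)
            (twoVertexClasses-left niceG niceH U))))
    where
    cgG = colouredGraph niceG
    module G = IsColouredGraph cgG

  fusion-noMatching : ∀ W → UnionOfTwoVertexClasses F W → ¬ InducesMatching F W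
  fusion-noMatching W U im with crossEdge? W
  ... | yes cross = crossEdge⇒¬matching U (proj₂ im) cross
  ... | no ¬cross = matching⇒¬¬crossEdge niceG niceH U im ¬cross

  fusion-nice : IsNiceCograph F
  fusion-nice = record
    { colouredGraph = colouredGraphF niceG niceH
    ; cograph       = fusion-cograph (F-adj-sym niceG niceH) (cograph niceG) (cograph niceH)
    ; classes≤2     = fusion-classesAtMostTwo (classes≤2 niceG) (classes≤2 niceH)
    ; noMatching    = fusion-noMatching
    }

lemma7 : (m n : ℕ) (G : RawCG (Fin m)) (H : RawCG (Fin n)) →
         IsNiceCograph G → IsNiceCograph H →
         (P : Portion G) (Q : Portion H) →
         IsNiceCograph (fusion G H P Q)
lemma7 m n G H niceG niceH P Q = FiniteFusion.fusion-nice G H P Q niceG niceH
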